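{- Let $R$ be an EPRF-TRS and $S$ be a TRS over a ranked alphabet $\Sigma$. Then it is decidable whether $\Rightarrow^*_S\subseteq\Rightarrow^*_R$ (as relations on $T_\Sigma(X)$).
   Context: A ranked alphabet $\Sigma$ is a finite set of symbols with ranks; $X=\{x_1,x_2,\dots\}$ is a countable set of variables, $T_\Sigma(X)$ the terms over $\Sigma$ and $X$, $T_\Sigma$ the ground terms. A TRS $R$ over $\Sigma$ is a finite set of rules $l\to r$, $l,r\in T_\Sigma(X)$, with every variable of $r$ occurring in $l$; $\Rightarrow_R$ is the rewrite relation, $\Rightarrow^*_R$ its reflexive transitive closure; $sign(R)$ is the set of symbols occurring in the rules. For $L\subseteq T_\Sigma$, $R^*_\Sigma(L)=\{p\mid q\Rightarrow^*_R p,\ q\in L\}$. A bottom-up tree automaton (bta) over $\Sigma$ is a finite automaton with states (treated as constants), final states, rules $\delta(a_1,\dots,a_n)\to a$ and $a\to a'$; it recognizes the ground terms rewriting to a final state. $R$ is an EPRF-TRS if for any given ranked alphabet $\Sigma\supseteq sign(R)$ and finite $L\subseteq T_\Sigma$ one can effectively construct a bta $\mathcal{C}$ over $\Sigma$ with $L(\mathcal{C})=R^*_\Sigma(L)$. -}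

module Defs where

open import Data.Nat using (ℕ)
open import Data.Fin using (Fin)
open import Data.Product using (Σ; _×_; _,_; proj₁; proj₂; ∃)
open import Data.List using (List; map)
open import Data.List.Membership.Propositional using (_∈_; _∉_)
open import Data.List.Relation.Unary.All as ListAll using ()
open import Data.Vec using (Vec; []; lookup; _[_]≔_)
import Data.Vec as Vec
open import Data.Vec.Relation.Unary.All as VecAll using ()
open import Data.Vec.Relation.Unary.Any as VecAny using ()
open import Relation.Binary.Construct.Closure.ReflexiveTransitive using (Star)
open import Function.Bundles using (_⇔_)

-- A function symbol: (name , rank).  Symbols are drawn from the countable
-- universe ℕ × ℕ; a ranked alphabet is a finite set (list) of symbols.
Sym : Set
Sym = ℕ × ℕ

rank : Sym → ℕ
rank = proj₂

Alphabet : Set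
Alphabet = List Sym

-- Terms over (all) symbols and the variables X = {x_0, x_1, ...} (indexed by ℕ).
data Term : Set where
  var : ℕ → Term
  app : (f : Sym) → Vec Term (rank f) → Term

data Over (A : Alphabet) : Term → Set where
  var : ∀ x → Over A (var x)
  app : ∀ f {ts} → f ∈ A → VecAll.All (Over A) ts → Over A (app f ts)

data Ground (A : Alphabet) : Term → Set where
  app : ∀ f {ts} → f ∈ A → VecAll.All (Ground A) ts → Ground A (app f ts)

data Occurs (x : ℕ) : Term → Set where
  here  : Occurs x (var x)
  under : ∀ f {ts} → VecAny.Any (Occurs x) ts → Occurs x (app f ts)

Subst : Set
Subst = ℕ → Term

mutual
  _⟪_⟫ : Term → Subst → Term
  var x ⟪ σ ⟫ = σ x
  app f ts ⟪ σ ⟫ = app f (substs ts σ)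

  substs : ∀ {n} → Vec Term n → Subst → Vec Term n
  substs [] σ = []
  substs (t Vec.∷ ts) σ = (t ⟪ σ ⟫) Vec.∷ substs ts σ

Rule : Set
Rule = Term × Term

IsTRS : List Rule → Set
IsTRS R = ListAll.All (λ lr → ∀ x → Occurs x (proj₂ lr) → Occurs x (proj₁ lr)) R

SignIn : List Rule → Alphabet → Set
SignIn R A = ListAll.All (λ lr → Over A (proj₁ lr) × Over A (proj₂ lr)) R

data Step (R : List Rule) : Term → Term → Set where
  root : ∀ {l r} → (l , r) ∈ R → (σ : Subst) → Step R (l ⟪ σ ⟫) (r ⟪ σ ⟫)
  cong : ∀ f (ts : Vec Term (rank f)) (i : Fin (rank f)) {u} →
         Step R (lookup ts i) u → Step R (app f ts) (app f (ts [ i ]≔ u))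

_⇒*[_]_ : Term → List Rule → Term → Set
s ⇒*[ R ] t = Star (Step R) s t

Desc : List Rule → List Term → Term → Set
Desc R L p = ∃ λ q → q ∈ L × (q ⇒*[ R ] p)

-- States are constants (rank 0 symbols (k , 0)), disjoint from Σ.
stateSym : ℕ → Sym
stateSym k = (k , 0)

stateTerm : ℕ → Term
stateTerm k = app (stateSym k) []

data BRule : Set where
  δrule : (f : Sym) → Vec ℕ (rank f) → ℕ → BRule
  εrule : ℕ → ℕ → BRule

toRule : BRule → Rule
toRule (δrule f as a) = app f (Vec.map stateTerm as) , stateTerm a
toRule (εrule a a') = stateTerm a , stateTerm a'

WFBRule : Alphabet → List ℕ → BRule → Set
WFBRule A Q (δrule f as a) = f ∈ A × VecAll.All (_∈ Q) as × a ∈ Q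
WFBRule A Q (εrule a a') = a ∈ Q × a' ∈ Q

record BTA (A : Alphabet) : Set where
  field
    states   : List ℕ
    disjoint : ListAll.All (λ k → stateSym k ∉ A) states
    final    : List ℕ
    finalOK  : ListAll.All (_∈ states) final
    rules    : List BRule
    rulesOK  : ListAll.All (WFBRule A states) rules

Lang : ∀ {A} → BTA A → Term → Set
Lang {A} C t = Ground A t × ∃ λ q → q ∈ BTA.final C × (t ⇒*[ map toRule (BTA.rules C) ] stateTerm q)

EPRF : List Rule → Set
EPRF R = (A : Alphabet) → SignIn R A →
         (L : List Term) → ListAll.All (Ground A) L →
         Σ (BTA A) λ C → ∀ t → Lang C t ⇔ Desc R L t

Included : Alphabet → List Rule → List Rule → Set
Included A S R = ∀ s t → Over A s → Over A t → s ⇒*[ S ] t → s ⇒*[ R ] t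

module Submission where

-- Since ⇒*_R is closed under substitutions and contexts, the inclusion holds
-- on T_Σ(X) iff every rule l → r of S satisfies l ⇒*_R r.  So it suffices to
-- decide l ⇒*_R r for terms l, r ∈ T_Σ(X), which we do as follows:
--   * freeze the variables of l and r into fresh constants, obtaining ground
--     terms lθ, rθ over an enlarged alphabet Σ' ⊇ Σ; thawing the constants
--     back into variables commutes with R-steps (sign(R) ⊆ Σ), hence
--     l ⇒*_R r  iff  lθ ⇒*_R rθ;
--   * EPRF applied to Σ' and L = {lθ} yields a bta C with L(C) = R^*_Σ'({lθ}),
--     so lθ ⇒*_R rθ iff rθ ∈ L(C);
--   * membership of a ground term in the language of a bta is decidable: a
--     term reaches a state iff it is obtained bottom-up by δ-rules followed by
--     paths in the finite graph of constant-to-constant rules.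

open import Defs
open import Data.Nat using (ℕ; zero; suc; _+_; _∸_; _<_; _≤?_; s≤s)
open import Data.Nat.Properties using (_≟_; m≤m+n; m≤n+m; m+n∸m≡n; ≤-trans; <⇒≱)
open import Data.Fin using (zero; suc)
open import Data.Product using (Σ; _×_; _,_; proj₁; proj₂; ∃)
open import Data.Product.Properties using (≡-dec)
open import Data.Sum using (_⊎_; inj₁; inj₂)
open import Data.Empty using (⊥-elim)
open import Data.Vec using (Vec; []; _∷_; lookup; _[_]≔_)
import Data.Vec as Vec
import Data.Vec.Relation.Unary.All as VecAll
open import Data.Vec.Relation.Binary.Pointwise.Inductive as Pointwise using (Pointwise; []; _∷_)
open import Data.List using (List; []; _∷_; map; _++_; concatMap)
import Data.List.Relation.Unary.All as ListAll
open import Data.List.Relation.Unary.Any using (Any; here; there; any?)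
open import Data.List.Membership.Propositional using (_∈_; find; lose)
open import Data.List.Membership.Propositional.Properties
  using (∈-map⁺; ∈-map⁻; ∈-++⁺ˡ; ∈-++⁺ʳ; ∈-concatMap⁺; ∈-concatMap⁻)
open import Relation.Binary.Construct.Closure.ReflexiveTransitive using (Star; ε; _◅_; _◅◅_; gmap)
open import Relation.Binary.PropositionalEquality
  using (_≡_; refl; sym; trans; subst; subst₂) renaming (cong to ≡-cong; cong₂ to ≡-cong₂)
open import Relation.Nullary using (Dec; yes; no)
open import Relation.Nullary.Decidable as Dec using (map′; _×-dec_; _⊎-dec_)
open import Function.Bundles using (_⇔_; mk⇔)
open import Function.Construct.Composition using (_⇔-∘_)

mutual
  subst-id : ∀ t → t ⟪ var ⟫ ≡ t
  subst-id (var x) = refl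
  subst-id (app f ts) = ≡-cong (app f) (substs-id ts)

  substs-id : ∀ {n} (ts : Vec Term n) → substs ts var ≡ ts
  substs-id [] = refl
  substs-id (t ∷ ts) = ≡-cong₂ _∷_ (subst-id t) (substs-id ts)

_；_ : Subst → Subst → Subst
(σ ； τ) x = σ x ⟪ τ ⟫

mutual
  subst-comp : ∀ t σ τ → t ⟪ σ ⟫ ⟪ τ ⟫ ≡ t ⟪ σ ； τ ⟫
  subst-comp (var x) σ τ = refl
  subst-comp (app f ts) σ τ = ≡-cong (app f) (substs-comp ts σ τ)

  substs-comp : ∀ {n} (ts : Vec Term n) σ τ → substs (substs ts σ) τ ≡ substs ts (σ ； τ)
  substs-comp [] σ τ = refl
  substs-comp (t ∷ ts) σ τ = ≡-cong₂ _∷_ (subst-comp t σ τ) (substs-comp ts σ τ)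

lookup-substs : ∀ {n} (ts : Vec Term n) i σ → lookup (substs ts σ) i ≡ lookup ts i ⟪ σ ⟫
lookup-substs (t ∷ ts) zero σ = refl
lookup-substs (t ∷ ts) (suc i) σ = lookup-substs ts i σ

substs-update : ∀ {n} (ts : Vec Term n) i u σ → substs (ts [ i ]≔ u) σ ≡ substs ts σ [ i ]≔ (u ⟪ σ ⟫)
substs-update (t ∷ ts) zero u σ = refl
substs-update (t ∷ ts) (suc i) u σ = ≡-cong ((t ⟪ σ ⟫) ∷_) (substs-update ts i u σ)

step-subst : ∀ {R} σ {s t} → Step R s t → Step R (s ⟪ σ ⟫) (t ⟪ σ ⟫)
step-subst {R} σ (root {l} {r} m τ) =
  subst₂ (Step R) (sym (subst-comp l τ σ)) (sym (subst-comp r τ σ)) (root m (τ ； σ))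
step-subst {R} σ (cong f ts i {u} s) =
  subst (λ vs → Step R (app f (substs ts σ)) (app f vs)) (sym (substs-update ts i u σ))
    (cong f (substs ts σ) i
      (subst (λ w → Step R w (u ⟪ σ ⟫)) (sym (lookup-substs ts i σ)) (step-subst σ s)))

star-subst : ∀ {R} σ {s t} → s ⇒*[ R ] t → (s ⟪ σ ⟫) ⇒*[ R ] (t ⟪ σ ⟫)
star-subst σ = gmap (_⟪ σ ⟫) (step-subst σ)

module _ {R : List Rule} where

  ArgsReduce : ∀ {n} → Vec Term n → Vec Term n → Set
  ArgsReduce = Pointwise (λ t v → t ⇒*[ R ] v)

  context-reduce : ∀ {n} (C : Vec Term n → Term) →
                   (∀ ts i u → Step R (lookup ts i) u → Step R (C ts) (C (ts [ i ]≔ u))) →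
                   ∀ {ts vs} → ArgsReduce ts vs → C ts ⇒*[ R ] C vs
  context-reduce C lift [] = ε
  context-reduce C lift {t ∷ ts} {v ∷ vs} (t⇒v ∷ ts⇒vs) =
    head t⇒v ◅◅ context-reduce (λ xs → C (v ∷ xs)) (λ xs i u → lift (v ∷ xs) (suc i) u) ts⇒vs
    where
      head : ∀ {a b} → a ⇒*[ R ] b → C (a ∷ ts) ⇒*[ R ] C (b ∷ ts)
      head ε = ε
      head {a} (s ◅ a⇒b) = lift (a ∷ ts) zero _ s ◅ head a⇒b

  args-cong : ∀ f {ts vs} → ArgsReduce ts vs → app f ts ⇒*[ R ] app f vs
  args-cong f = context-reduce (app f) (λ ts i u → cong f ts i)

  update-reduces : ∀ {n} (ts : Vec Term n) i {u} → lookup ts i ⇒*[ R ] u → ArgsReduce ts (ts [ i ]≔ u)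
  update-reduces (t ∷ ts) zero t⇒u = t⇒u ∷ Pointwise.refl ε
  update-reduces (t ∷ ts) (suc i) t⇒u = ε ∷ update-reduces ts i t⇒u

Derivable : List Rule → List Rule → Set
Derivable R S = ListAll.All (λ lr → proj₁ lr ⇒*[ R ] proj₂ lr) S

-- If the rules of S are derivable in R, then so is every S-rewrite: a root
-- step is an instance of a derivable rule, and R-reductions pass into contexts.
step-derivable : ∀ {R S} → Derivable R S → ∀ {s t} → Step S s t → s ⇒*[ R ] t
step-derivable der (root m σ) = star-subst σ (ListAll.lookup der m)
step-derivable der (cong f ts i s) = args-cong f (update-reduces ts i (step-derivable der s))

star-derivable : ∀ {R S} → Derivable R S → ∀ {s t} → s ⇒*[ S ] t → s ⇒*[ R ] t
star-derivable der ε = ε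
star-derivable der (s ◅ ss) = step-derivable der s ◅◅ star-derivable der ss

derivable⇔included : ∀ {A R S} → SignIn S A → Derivable R S ⇔ Included A S R
derivable⇔included {A} {R} {S} sigS = mk⇔ (λ der s t _ _ → star-derivable der) rules-derivable
  where
    rules-derivable : Included A S R → Derivable R S
    rules-derivable incl = ListAll.tabulate λ {(l , r)} m →
      let (ol , or) = ListAll.lookup sigS m
      in incl l r ol or (subst₂ (Step S) (subst-id l) (subst-id r) (root m var) ◅ ε)

all?-under : ∀ {X : Set} {P Q : X → Set} {xs} → ListAll.All P xs →
             (∀ {x} → P x → Dec (Q x)) → Dec (ListAll.All Q xs)
all?-under ListAll.[] q? = yes ListAll.[]
all?-under (px ListAll.∷ pxs) q? = map′ (λ (qx , qxs) → qx ListAll.∷ qxs) ListAll.uncons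
                                      (q? px ×-dec all?-under pxs q?)

-- A bound on the names of symbols of an alphabet; names above it are fresh.
nameBound : Alphabet → ℕ
nameBound [] = 0
nameBound (f ∷ A) = proj₁ f + nameBound A

name<bound : ∀ {f A} → f ∈ A → proj₁ f < suc (nameBound A)
name<bound {A = g ∷ A} (here refl) = s≤s (m≤m+n (proj₁ g) (nameBound A))
name<bound {A = g ∷ A} (there m) = ≤-trans (name<bound m) (s≤s (m≤n+m (nameBound A) (proj₁ g)))

-- The variables of a term (with repetitions); only these need fresh constants.
mutual
  vars : Term → List ℕ
  vars (var x) = x ∷ []
  vars (app f ts) = varsV ts

  varsV : ∀ {n} → Vec Term n → List ℕ
  varsV [] = []
  varsV (t ∷ ts) = vars t ++ varsV ts

mutual
  over-weaken : ∀ {A B} → (∀ {f} → f ∈ A → f ∈ B) → ∀ {t} → Over A t → Over B t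
  over-weaken A⊆B (var x) = var x
  over-weaken A⊆B (app f m ots) = app f (A⊆B m) (overs-weaken A⊆B ots)

  overs-weaken : ∀ {A B} → (∀ {f} → f ∈ A → f ∈ B) →
                 ∀ {n} {ts : Vec Term n} → VecAll.All (Over A) ts → VecAll.All (Over B) ts
  overs-weaken A⊆B VecAll.[] = VecAll.[]
  overs-weaken A⊆B (ot VecAll.∷ ots) = over-weaken A⊆B ot VecAll.∷ overs-weaken A⊆B ots

module Freeze (A : Alphabet) where

  offset : ℕ
  offset = suc (nameBound A)

  frozenSym : ℕ → Sym
  frozenSym x = (offset + x , 0)

  freeze : Subst
  freeze x = app (frozenSym x) []

  thawConst : ℕ → Term
  thawConst n with offset ≤? n
  ... | yes _ = var (n ∸ offset)
  ... | no _ = app (n , 0) []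

  mutual
    thaw : Term → Term
    thaw (var x) = var x
    thaw (app (n , zero) []) = thawConst n
    thaw (app (n , suc k) ts) = app (n , suc k) (thaws ts)

    thaws : ∀ {n} → Vec Term n → Vec Term n
    thaws [] = []
    thaws (t ∷ ts) = thaw t ∷ thaws ts

  thaw-frozen : ∀ x → thawConst (offset + x) ≡ var x
  thaw-frozen x with offset ≤? offset + x
  ... | yes _ = ≡-cong var (m+n∸m≡n offset x)
  ... | no ≰ = ⊥-elim (≰ (m≤m+n offset x))

  thaw-old : ∀ {n} → n < offset → thawConst n ≡ app (n , 0) []
  thaw-old {n} n<offset with offset ≤? n
  ... | yes offset≤n = ⊥-elim (<⇒≱ n<offset offset≤n)
  ... | no _ = refl

  mutual
    thaw-subst : ∀ {l} → Over A l → ∀ σ τ → (∀ x → thaw (σ x) ≡ τ x) → thaw (l ⟪ σ ⟫) ≡ l ⟪ τ ⟫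
    thaw-subst (var x) σ τ eq = eq x
    thaw-subst (app (n , zero) {[]} m VecAll.[]) σ τ eq = thaw-old (name<bound m)
    thaw-subst (app (n , suc k) m ots) σ τ eq = ≡-cong (app (n , suc k)) (thaws-subst ots σ τ eq)

    thaws-subst : ∀ {n} {ts : Vec Term n} → VecAll.All (Over A) ts →
                  ∀ σ τ → (∀ x → thaw (σ x) ≡ τ x) → thaws (substs ts σ) ≡ substs ts τ
    thaws-subst VecAll.[] σ τ eq = refl
    thaws-subst (ot VecAll.∷ ots) σ τ eq = ≡-cong₂ _∷_ (thaw-subst ot σ τ eq) (thaws-subst ots σ τ eq)

  thaw-freeze : ∀ {t} → Over A t → thaw (t ⟪ freeze ⟫) ≡ t
  thaw-freeze {t} ot = trans (thaw-subst ot freeze var thaw-frozen) (subst-id t)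

  lookup-thaws : ∀ {n} (ts : Vec Term n) i → lookup (thaws ts) i ≡ thaw (lookup ts i)
  lookup-thaws (t ∷ ts) zero = refl
  lookup-thaws (t ∷ ts) (suc i) = lookup-thaws ts i

  thaws-update : ∀ {n} (ts : Vec Term n) i u → thaws (ts [ i ]≔ u) ≡ thaws ts [ i ]≔ thaw u
  thaws-update (t ∷ ts) zero u = refl
  thaws-update (t ∷ ts) (suc i) u = ≡-cong (thaw t ∷_) (thaws-update ts i u)

  -- Thawing maps R-steps to R-steps, as the rules of R are over A.
  thaw-step : ∀ {R} → SignIn R A → ∀ {s t} → Step R s t → Step R (thaw s) (thaw t)
  thaw-step {R} sig (root {l} {r} m σ) =
    let (ol , or) = ListAll.lookup sig m
        thawσ = λ x → thaw (σ x)
    in subst₂ (Step R) (sym (thaw-subst ol σ thawσ λ _ → refl))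
                       (sym (thaw-subst or σ thawσ λ _ → refl)) (root m thawσ)
  thaw-step sig (cong (n , zero) ts () s)
  thaw-step {R} sig (cong (n , suc k) ts i {u} s) =
    subst (λ vs → Step R (app (n , suc k) (thaws ts)) (app (n , suc k) vs)) (sym (thaws-update ts i u))
      (cong (n , suc k) (thaws ts) i
        (subst (λ w → Step R w (thaw u)) (sym (lookup-thaws ts i)) (thaw-step sig s)))

  frozen⇔ : ∀ {R l r} → SignIn R A → Over A l → Over A r →
            (l ⟪ freeze ⟫) ⇒*[ R ] (r ⟪ freeze ⟫) ⇔ l ⇒*[ R ] r
  frozen⇔ {R} sig ol or = mk⇔
    (λ frozen → subst₂ (λ a b → a ⇒*[ R ] b) (thaw-freeze ol) (thaw-freeze or)
                       (gmap thaw (thaw-step sig) frozen))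
    (star-subst freeze)

  extended : List ℕ → Alphabet
  extended vs = A ++ map frozenSym vs

  mutual
    freeze-ground : ∀ {vs t} → Over A t → (∀ {x} → x ∈ vars t → x ∈ vs) → Ground (extended vs) (t ⟪ freeze ⟫)
    freeze-ground (var x) vars⊆ =
      app (frozenSym x) (∈-++⁺ʳ A (∈-map⁺ frozenSym (vars⊆ (here refl)))) VecAll.[]
    freeze-ground (app f m ots) vars⊆ = app f (∈-++⁺ˡ m) (freezes-ground ots vars⊆)

    freezes-ground : ∀ {vs n} {ts : Vec Term n} → VecAll.All (Over A) ts →
                     (∀ {x} → x ∈ varsV ts → x ∈ vs) → VecAll.All (Ground (extended vs)) (substs ts freeze)
    freezes-ground VecAll.[] vars⊆ = VecAll.[]
    freezes-ground {ts = t ∷ ts} (ot VecAll.∷ ots) vars⊆ =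
      freeze-ground ot (λ x∈ → vars⊆ (∈-++⁺ˡ x∈)) VecAll.∷
      freezes-ground ots (λ x∈ → vars⊆ (∈-++⁺ʳ (vars t) x∈))

Path : List (ℕ × ℕ) → ℕ → ℕ → Set
Path G = Star (λ a b → (a , b) ∈ G)

-- A path using an extra edge u → v either avoids it, or splits into a path
-- to u and a path from v (later uses of the edge are shortcut).
path-split : ∀ {u v G a q} → Path ((u , v) ∷ G) a q → Path G a q ⊎ (Path G a u × Path G v q)
path-split ε = inj₁ ε
path-split (here refl ◅ p) with path-split p
... | inj₁ v⇝q = inj₂ (ε , v⇝q)
... | inj₂ (_ , v⇝q) = inj₂ (ε , v⇝q)
path-split (there e ◅ p) with path-split p
... | inj₁ b⇝q = inj₁ (e ◅ b⇝q)
... | inj₂ (b⇝u , v⇝q) = inj₂ (e ◅ b⇝u , v⇝q)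

path-weaken : ∀ {e G a q} → Path G a q → Path (e ∷ G) a q
path-weaken = gmap (λ a → a) there

path? : ∀ G a q → Dec (Path G a q)
path? [] a q with a ≟ q
... | yes refl = yes ε
... | no a≢q = no λ { ε → a≢q refl ; (() ◅ _) }
path? ((u , v) ∷ G) a q =
  map′ (λ { (inj₁ a⇝q) → path-weaken a⇝q
          ; (inj₂ (a⇝u , v⇝q)) → path-weaken a⇝u ◅◅ (here refl ◅ path-weaken v⇝q) })
       path-split
       (path? G a q ⊎-dec (path? G a u ×-dec path? G v q))

_≟-sym_ : (f g : Sym) → Dec (f ≡ g)
_≟-sym_ = ≡-dec _≟_ _≟_

module BtaRun (rules : List BRule) where

  Rbta : List Rule
  Rbta = map toRule rules

  -- The rules that rewrite one constant to another: ε-rules a → b and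
  -- nullary δ-rules c → b (the constant c is also the state c).
  chain : BRule → List (ℕ × ℕ)
  chain (εrule a b) = (a , b) ∷ []
  chain (δrule (c , zero) [] b) = (c , b) ∷ []
  chain (δrule (c , suc k) as b) = []

  chainEdges : List (ℕ × ℕ)
  chainEdges = concatMap chain rules

  chain-rule : ∀ {ρ a b} → (a , b) ∈ chain ρ → toRule ρ ≡ (stateTerm a , stateTerm b)
  chain-rule {εrule a b} (here refl) = refl
  chain-rule {δrule (c , zero) [] b} (here refl) = refl

  edge-step : ∀ {a b} → (a , b) ∈ chainEdges → Step Rbta (stateTerm a) (stateTerm b)
  edge-step e with find (∈-concatMap⁻ chain e)
  ... | ρ , ρ∈ , e∈ = root (subst (_∈ Rbta) (chain-rule e∈) (∈-map⁺ toRule ρ∈)) var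

  mutual
    data Direct : Term → ℕ → Set where
      state : ∀ a → Direct (stateTerm a) a
      δ : ∀ {f ts as a} → δrule f as a ∈ rules → ReachAll ts as → Direct (app f ts) a

    data ReachAll : ∀ {n} → Vec Term n → Vec ℕ n → Set where
      [] : ReachAll [] []
      _∷_ : ∀ {n t a} {ts : Vec Term n} {as} → Reaches t a → ReachAll ts as → ReachAll (t ∷ ts) (a ∷ as)

    data Reaches (t : Term) (q : ℕ) : Set where
      reaches : ∀ a → Direct t a → Path chainEdges a q → Reaches t q

  direct-state : ∀ {b a} → Direct (stateTerm b) a → Path chainEdges b a
  direct-state (state _) = ε
  direct-state (δ {as = []} m []) = ∈-concatMap⁺ chain (lose m (here refl)) ◅ ε

  state-reaches : ∀ a → Reaches (stateTerm a) a
  state-reaches a = reaches a (state a) ε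

  states-reach : ∀ {n} (as : Vec ℕ n) → ReachAll (Vec.map stateTerm as) as
  states-reach [] = []
  states-reach (a ∷ as) = state-reaches a ∷ states-reach as

  -- Left-hand sides of bta rules are ground, hence fixed by substitutions.
  states-ground : ∀ {n} (as : Vec ℕ n) σ → substs (Vec.map stateTerm as) σ ≡ Vec.map stateTerm as
  states-ground [] σ = refl
  states-ground (a ∷ as) σ = ≡-cong (stateTerm a ∷_) (states-ground as σ)

  reachAll-update : ∀ {n} (ts : Vec Term n) i {u as} → ReachAll (ts [ i ]≔ u) as →
                    (∀ {q} → Reaches u q → Reaches (lookup ts i) q) → ReachAll ts as
  reachAll-update (t ∷ ts) zero (u↝ ∷ ts↝) back = back u↝ ∷ ts↝
  reachAll-update (t ∷ ts) (suc i) (t↝ ∷ ts↝) back = t↝ ∷ reachAll-update ts i ts↝ back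

  reaches-back : ∀ {t t' q} → Step Rbta t t' → Reaches t' q → Reaches t q
  reaches-back (root m σ) t'↝q with ∈-map⁻ toRule m
  reaches-back (root m σ) (reaches a' d p) | εrule a b , ρ∈ , refl =
    reaches a (state a) ((∈-concatMap⁺ chain (lose ρ∈ (here refl))) ◅ (direct-state d ◅◅ p))
  reaches-back {q = q} (root m σ) (reaches a' d p) | δrule f as a , ρ∈ , refl =
    subst (λ ts → Reaches (app f ts) q) (sym (states-ground as σ))
          (reaches a (δ ρ∈ (states-reach as)) (direct-state d ◅◅ p))
  reaches-back (cong (n , zero) ts () s) t'↝q
  reaches-back (cong (n , suc k) ts i s) (reaches a (δ m ts↝) p) =
    reaches a (δ m (reachAll-update ts i ts↝ (reaches-back s))) p

  reaches-complete : ∀ {t q} → t ⇒*[ Rbta ] stateTerm q → Reaches t q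
  reaches-complete {q = q} ε = state-reaches q
  reaches-complete (s ◅ ss) = reaches-back s (reaches-complete ss)

  path-sound : ∀ {a q} → Path chainEdges a q → stateTerm a ⇒*[ Rbta ] stateTerm q
  path-sound = gmap stateTerm edge-step

  mutual
    reaches-sound : ∀ {t q} → Reaches t q → t ⇒*[ Rbta ] stateTerm q
    reaches-sound (reaches a d p) = direct-sound d ◅◅ path-sound p

    direct-sound : ∀ {t a} → Direct t a → t ⇒*[ Rbta ] stateTerm a
    direct-sound (state a) = ε
    direct-sound (δ {f} {ts} {as} {a} m ts↝) =
      args-cong f (reachAll-sound ts↝) ◅◅
      (subst (λ lhs → Step Rbta lhs (stateTerm a)) (≡-cong (app f) (states-ground as var))
             (root (∈-map⁺ toRule m) var) ◅ ε)

    reachAll-sound : ∀ {n} {ts : Vec Term n} {as} → ReachAll ts as → ArgsReduce {Rbta} ts (Vec.map stateTerm as)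
    reachAll-sound [] = []
    reachAll-sound (t↝ ∷ ts↝) = reaches-sound t↝ ∷ reachAll-sound ts↝

  -- Deciding Reaches: the only candidates for the direct state of t are its
  -- own name (if t is a constant) and the targets of the rules.
  target : BRule → ℕ
  target (δrule _ _ a) = a
  target (εrule _ b) = b

  candidates : Term → List ℕ
  candidates (var x) = []
  candidates (app f ts) = proj₁ f ∷ map target rules

  direct-candidate : ∀ {t a} → Direct t a → a ∈ candidates t
  direct-candidate (state a) = here refl
  direct-candidate (δ m _) = there (∈-map⁺ target m)

  Fires : ∀ f → Vec Term (rank f) → ℕ → BRule → Set
  Fires f ts a ρ = Σ (Vec ℕ (rank f)) λ as → ρ ≡ δrule f as a × ReachAll ts as

  fires-direct : ∀ {f ts a} → Any (Fires f ts a) rules → Direct (app f ts) a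
  fires-direct fires with find fires
  ... | _ , m , as , refl , ts↝ = δ m ts↝

  mutual
    reaches? : ∀ t q → Dec (Reaches t q)
    reaches? t q =
      map′ (λ any → via (find any))
           (λ { (reaches a d p) → lose (direct-candidate d) (d , p) })
           (any? (λ a → direct? t a ×-dec path? chainEdges a q) (candidates t))
      where
        via : (∃ λ a → a ∈ candidates t × (Direct t a × Path chainEdges a q)) → Reaches t q
        via (a , _ , d , p) = reaches a d p

    direct? : ∀ t a → Dec (Direct t a)
    direct? (var x) a = no λ ()
    direct? (app (n , zero) []) a with n ≟ a
    ... | yes refl = yes (state n)
    ... | no n≢a = map′ fires-direct
                        (λ { (state _) → ⊥-elim (n≢a refl) ; (δ m ts↝) → lose m (_ , refl , ts↝) })
                        (any? (fires? (n , zero) [] a) rules)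
    direct? (app (n , suc k) ts) a = map′ fires-direct (λ { (δ m ts↝) → lose m (_ , refl , ts↝) })
                                          (any? (fires? (n , suc k) ts a) rules)

    fires? : ∀ f ts a ρ → Dec (Fires f ts a ρ)
    fires? f ts a (εrule _ _) = no λ { (_ , () , _) }
    fires? f ts a (δrule f' as a') with f' ≟-sym f | a' ≟ a
    ... | yes refl | yes refl = map′ (λ ts↝ → as , refl , ts↝) (λ { (_ , refl , ts↝) → ts↝ }) (reachAll? ts as)
    ... | no f'≢f | _ = no λ { (_ , refl , _) → f'≢f refl }
    ... | yes refl | no a'≢a = no λ { (_ , refl , _) → a'≢a refl }

    reachAll? : ∀ {n} (ts : Vec Term n) as → Dec (ReachAll ts as)
    reachAll? [] [] = yes []
    reachAll? (t ∷ ts) (a ∷ as) =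
      map′ (λ (t↝ , ts↝) → t↝ ∷ ts↝) (λ { (t↝ ∷ ts↝) → t↝ , ts↝ }) (reaches? t a ×-dec reachAll? ts as)

lang? : ∀ {A} (C : BTA A) t → Ground A t → Dec (Lang C t)
lang? C t g =
  map′ (λ any → let (q , q∈ , t↝q) = find any in g , q , q∈ , reaches-sound t↝q)
       (λ (_ , q , q∈ , t⇒q) → lose q∈ (reaches-complete t⇒q))
       (any? (reaches? t) (BTA.final C))
  where open BtaRun (BTA.rules C)

desc-singleton⇔ : ∀ {R s t} → Desc R (s ∷ []) t ⇔ s ⇒*[ R ] t
desc-singleton⇔ {s = s} = mk⇔ (λ { (_ , here refl , s⇒t) → s⇒t }) (λ s⇒t → s , here refl , s⇒t)

reduces? : ∀ {A R} → SignIn R A → EPRF R → ∀ {l r} → Over A l → Over A r → Dec (l ⇒*[ R ] r)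
reduces? {A} {R} sig eprf {l} {r} ol or =
  Dec.map (frozen⇔ sig ol or ⇔-∘ (desc-singleton⇔ ⇔-∘ lang⇔desc (r ⟪ freeze ⟫)))
          (lang? C (r ⟪ freeze ⟫) gr)
  where
    open Freeze A
    A' : Alphabet
    A' = extended (vars l ++ vars r)
    sig' : SignIn R A'
    sig' = ListAll.map (λ (ol' , or') → over-weaken ∈-++⁺ˡ ol' , over-weaken ∈-++⁺ˡ or') sig
    gl : Ground A' (l ⟪ freeze ⟫)
    gl = freeze-ground ol ∈-++⁺ˡ
    gr : Ground A' (r ⟪ freeze ⟫)
    gr = freeze-ground or (∈-++⁺ʳ (vars l))
    C : BTA A'
    C = proj₁ (eprf A' sig' (l ⟪ freeze ⟫ ∷ []) (gl ListAll.∷ ListAll.[]))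
    lang⇔desc : ∀ t → Lang C t ⇔ Desc R (l ⟪ freeze ⟫ ∷ []) t
    lang⇔desc = proj₂ (eprf A' sig' (l ⟪ freeze ⟫ ∷ []) (gl ListAll.∷ ListAll.[]))

mainTheorem6 : (A : Alphabet) (R S : List Rule) →
               IsTRS R → SignIn R A → EPRF R →
               IsTRS S → SignIn S A →
               Dec (Included A S R)
mainTheorem6 A R S _ sigR eprf _ sigS =
  Dec.map (derivable⇔included sigS)
          (all?-under sigS (λ (ol , or) → reduces? sigR eprf ol or))
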